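{- The cohomology $H^2(G,M)\cong\ker d^2/\mathrm{im}\,d^1$ is a $13$-dimensional $\mathbb{F}_3$-vector space, with basis the classes of the triples $(x,y,z)\in M^3$: $(f+ef+e^2f,0,0)$; $(f^2+ef^2+e^2f^2,0,0)$; $(e+ef+ef^2,0,0)$; $(e^2+e^2f+e^2f^2,0,0)$; $(0,f^2-e^2f^2,0)$; $(0,ef^2-e^2f^2,0)$; $(0,e^2-e^2f^2,0)$; $(0,e^2f-e^2f^2,0)$; $(0,0,1-ef-ef^2-e^2f-e^2f^2)$; $(0,0,f+ef+e^2f)$; $(0,0,f^2+ef^2+e^2f^2)$; $(0,0,e+ef+ef^2)$; $(0,0,e^2+e^2f+e^2f^2)$.
   Context: Let $\zeta$ be a primitive cube root of unity, $K=\mathbb{Q}(\zeta)$, $L=K(\sqrt[3]{\zeta},\sqrt[3]{1-\zeta^{ -1}})$, and $G=\mathrm{Gal}(L/K)\cong(\mathbb{Z}/3)^2$, generated by $\sigma,\tau$ with $\sigma(\sqrt[3]{\zeta})=\zeta\sqrt[3]{\zeta}$, $\sigma$ fixing $\sqrt[3]{1-\zeta^{ -1}}$, $\tau$ fixing $\sqrt[3]{\zeta}$, $\tau(\sqrt[3]{1-\zeta^{ -1}})=\zeta\sqrt[3]{1-\zeta^{ -1}}$. Let $M=\mathbb{F}_3[e,f]/(e^3-1,f^3-1)$, the Galois module $H_1(U,Y;\mathbb{F}_3)$ for the affine Fermat curve $U:x^3+y^3=1$ relative to $Y:xy=0$, with $G$ acting by $\sigma\cdot m=B_\sigma m$, $\tau\cdot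 m=B_\tau m$, where $B_\sigma=1-(e+f)(1-e)(1-f)$ and $B_\tau=1+(e+f)-(e^2+ef+f^2)+e^2f^2$. With $N_\sigma=1+\sigma+\sigma^2$, $N_\tau=1+\tau+\tau^2$, the cohomology of $G$ is computed by the complex $M\xrightarrow{d^0}M^2\xrightarrow{d^1}M^3\xrightarrow{d^2}M^4$, $d^0(m)=((1-\sigma)m,(1-\tau)m)$, $d^1(a,b)=(N_\sigma a,(1-\tau)a-(1-\sigma)b,N_\tau b)$, $d^2(x,y,z)=((1-\sigma)x,(1-\tau)x-N_\sigma y,N_\tau y+(1-\sigma)z,(1-\tau)z)$. -}

module Defs where

open import Data.Fin using (Fin; zero; suc)
open import Data.Vec using (Vec; []; _∷_; lookup; tabulate; replicate)
open import Data.Product using (_×_; _,_)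

data F3 : Set where
  𝟘 𝟙 𝟚 : F3

infixl 6 _+₃_
infixl 7 _*₃_

_+₃_ : F3 → F3 → F3
𝟘 +₃ y = y
𝟙 +₃ 𝟘 = 𝟙
𝟙 +₃ 𝟙 = 𝟚
𝟙 +₃ 𝟚 = 𝟘
𝟚 +₃ 𝟘 = 𝟚
𝟚 +₃ 𝟙 = 𝟘
𝟚 +₃ 𝟚 = 𝟙

-₃_ : F3 → F3
-₃ 𝟘 = 𝟘
-₃ 𝟙 = 𝟚
-₃ 𝟚 = 𝟙

_*₃_ : F3 → F3 → F3
𝟘 *₃ y = 𝟘
𝟙 *₃ y = y
𝟚 *₃ y = -₃ y

_⊖_ : Fin 3 → Fin 3 → Fin 3
i ⊖ zero = i
zero ⊖ suc zero = suc (suc zero)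
suc zero ⊖ suc zero = zero
suc (suc zero) ⊖ suc zero = suc zero
zero ⊖ suc (suc zero) = suc zero
suc zero ⊖ suc (suc zero) = suc (suc zero)
suc (suc zero) ⊖ suc (suc zero) = zero

-- M = F₃[e,f]/(e³-1, f³-1).  An element is a 3×3 table of
-- coefficients: entry [i][j] is the coefficient of e^i f^j.

M : Set
M = Vec (Vec F3 3) 3

coef : M → Fin 3 → Fin 3 → F3
coef m i j = lookup (lookup m i) j

toM : (Fin 3 → Fin 3 → F3) → M
toM g = tabulate λ i → tabulate λ j → g i j

sum3 : (Fin 3 → F3) → F3
sum3 g = g zero +₃ g (suc zero) +₃ g (suc (suc zero))

infixl 6 _+M_ _-M_
infixl 7 _*M_ _·M_

_+M_ : M → M → M
a +M b = toM λ i j → coef a i j +₃ coef b i j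

-M_ : M → M
-M a = toM λ i j → -₃ coef a i j

_-M_ : M → M → M
a -M b = a +M (-M b)

_·M_ : F3 → M → M
c ·M a = toM λ i j → c *₃ coef a i j

_*M_ : M → M → M
a *M b = toM λ i j → sum3 λ k → sum3 λ l → coef a k l *₃ coef b (i ⊖ k) (j ⊖ l)

0M : M
0M = replicate 3 (replicate 3 𝟘)

1M : M
1M = (𝟙 ∷ 𝟘 ∷ 𝟘 ∷ []) ∷ (𝟘 ∷ 𝟘 ∷ 𝟘 ∷ []) ∷ (𝟘 ∷ 𝟘 ∷ 𝟘 ∷ []) ∷ []

e : M
e = (𝟘 ∷ 𝟘 ∷ 𝟘 ∷ []) ∷ (𝟙 ∷ 𝟘 ∷ 𝟘 ∷ []) ∷ (𝟘 ∷ 𝟘 ∷ 𝟘 ∷ []) ∷ []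

f : M
f = (𝟘 ∷ 𝟙 ∷ 𝟘 ∷ []) ∷ (𝟘 ∷ 𝟘 ∷ 𝟘 ∷ []) ∷ (𝟘 ∷ 𝟘 ∷ 𝟘 ∷ []) ∷ []

Bσ : M
Bσ = 1M -M (e +M f) *M (1M -M e) *M (1M -M f)

Bτ : M
Bτ = 1M +M (e +M f) -M (e *M e +M e *M f +M f *M f) +M e *M e *M f *M f

σ· : M → M
σ· m = Bσ *M m

τ· : M → M
τ· m = Bτ *M m

Nσ : M → M
Nσ m = m +M σ· m +M σ· (σ· m)

Nτ : M → M
Nτ m = m +M τ· m +M τ· (τ· m)

Dσ : M → M
Dσ m = m -M σ· m

Dτ : M → M
Dτ m = m -M τ· m

M2 M3 M4 : Set
M2 = M × M
M3 = M × M × M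
M4 = M × M × M × M

d0 : M → M2
d0 m = Dσ m , Dτ m

d1 : M2 → M3
d1 (a , b) = Nσ a , (Dτ a -M Dσ b) , Nτ b

d2 : M3 → M4
d2 (x , y , z) = Dσ x , (Dτ x -M Nσ y) , (Nτ y +M Dσ z) , Dτ z

0M3 : M3
0M3 = 0M , 0M , 0M

0M4 : M4
0M4 = 0M , 0M , 0M , 0M

_+M3_ : M3 → M3 → M3
(x , y , z) +M3 (x' , y' , z') = x +M x' , y +M y' , z +M z'

_·M3_ : F3 → M3 → M3
c ·M3 (x , y , z) = c ·M x , c ·M y , c ·M z

e² f² : M
e² = e *M e
f² = f *M f

basis : Vec M3 13
basis =
    (f +M e *M f +M e² *M f , 0M , 0M)
  ∷ (f² +M e *M f² +M e² *M f² , 0M , 0M)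
  ∷ (e +M e *M f +M e *M f² , 0M , 0M)
  ∷ (e² +M e² *M f +M e² *M f² , 0M , 0M)
  ∷ (0M , f² -M e² *M f² , 0M)
  ∷ (0M , e *M f² -M e² *M f² , 0M)
  ∷ (0M , e² -M e² *M f² , 0M)
  ∷ (0M , e² *M f -M e² *M f² , 0M)
  ∷ (0M , 0M , 1M -M e *M f -M e *M f² -M e² *M f -M e² *M f²)
  ∷ (0M , 0M , f +M e *M f +M e² *M f)
  ∷ (0M , 0M , f² +M e *M f² +M e² *M f²)
  ∷ (0M , 0M , e +M e *M f +M e *M f²)
  ∷ (0M , 0M , e² +M e² *M f +M e² *M f²)
  ∷ []

lincomb : ∀ {n} → Vec F3 n → Vec M3 n → M3
lincomb [] [] = 0M3
lincomb (c ∷ cs) (v ∷ vs) = (c ·M3 v) +M3 lincomb cs vs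

module Submission where

-- Everything in sight is 𝔽₃-linear, because σ and τ act on M by multiplication with the
-- units Bσ and Bτ of the group algebra.  The theorem is certified by three linear maps given
-- by explicit matrices, coordinates : M³ → 𝔽₃¹³, h² : M³ → M² and h³ : M⁴ → M³, such that
--   w = Σᵢ coordinatesᵢ(w) bᵢ + d¹(h² w) + h³(d² w)   for all w ∈ M³,
--   coordinates ∘ d¹ = 0   and   coordinates(bᵢ) = eᵢ.
-- The first identity shows that every cocycle is a combination of the bᵢ modulo coboundaries;
-- applying coordinates to d¹(a, b) = Σᵢ cᵢ bᵢ gives c = 0.  Identities between linear maps
-- need only be checked on unit vectors, and those finitely many checks (and d²(bᵢ) = 0) are
-- done by evaluation.

open import Algebra.Bundles using (CommutativeSemigroup)
open import Algebra.Core using (Op₂)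
open import Algebra.Definitions using (Associative; Commutative; RightIdentity; Interchangable)
import Algebra.Morphism.Definitions as MorphismDefinitions
import Algebra.Properties.CommutativeSemigroup as CommutativeSemigroupProperties
open import Data.Fin using (Fin; zero; suc; combine)
open import Data.Fin.Properties using (all?)
open import Data.Nat using (zero; suc; _*_)
open import Data.Product using (_×_; ∃; _,_)
import Data.Product.Properties as Product
open import Data.Vec using (Vec; []; _∷_; lookup; replicate; tabulate; map; zipWith; concat)
import Data.Vec.Properties as Vec
open import Data.Vec.Properties
  using ( lookup∘tabulate; tabulate∘lookup; tabulate-cong; lookup-zipWith; lookup-concat; lookup-map
        ; lookup-replicate; zipWith-identityˡ)
open import Data.Vec.Recursive using (_^_; fromVec; toVec)
  renaming (zipWith to zipWithⁿ; tabulate to tabulateⁿ; replicate to replicateⁿ)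
open import Data.Vec.Recursive.Properties using (fromVec∘toVec)
open import Function using (_∘_)
open import Relation.Binary.Definitions using (DecidableEquality)
open import Relation.Binary.PropositionalEquality
  using (_≡_; refl; sym; trans; cong; cong₂; _≗_; module ≡-Reasoning)
open import Relation.Binary.PropositionalEquality.Algebra using (isMagma)
open import Relation.Nullary using (yes; no)
open import Relation.Nullary.Decidable using (from-yes)

open import Defs

open ≡-Reasoning

≡-commutativeSemigroup : {A : Set} (_∙_ : Op₂ A) →
  Associative _≡_ _∙_ → Commutative _≡_ _∙_ → CommutativeSemigroup _ _
≡-commutativeSemigroup _∙_ assoc comm = record
  { isCommutativeSemigroup = record
    { isSemigroup = record { isMagma = isMagma _∙_ ; assoc = assoc }
    ; comm = comm
    }
  }

Additive : {A B : Set} → Op₂ A → Op₂ B → (A → B) → Set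
Additive {A} {B} _+ᴬ_ _+ᴮ_ F = MorphismDefinitions.Homomorphic₂ A B _≡_ F _+ᴬ_ _+ᴮ_

module _ {A B : Set} (_+ᴬ_ : Op₂ A) (_+ᴮ_ : Op₂ B) where

  additive-≗ : {F G : A → B} → Additive _+ᴬ_ _+ᴮ_ F → F ≗ G → Additive _+ᴬ_ _+ᴮ_ G
  additive-≗ {F} {G} F-+ F≗G x y =
    trans (sym (F≗G (x +ᴬ y))) (trans (F-+ x y) (cong₂ _+ᴮ_ (F≗G x) (F≗G y)))

  -- Switching to a definitionally equal addition this way avoids letting the type checker
  -- compare F (x +ᴬ′ y) with F (x +ᴬ y), which can force a symbolic evaluation of F.
  additive-change-domain : (_+ᴬ′_ : Op₂ A) → (∀ x y → x +ᴬ′ y ≡ x +ᴬ y) →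
    {F : A → B} → Additive _+ᴬ_ _+ᴮ_ F → Additive _+ᴬ′_ _+ᴮ_ F
  additive-change-domain _+ᴬ′_ same {F} F-+ x y = trans (cong F (same x y)) (F-+ x y)

  additive-+ : Interchangable _≡_ _+ᴮ_ _+ᴮ_ → {F G : A → B} →
    Additive _+ᴬ_ _+ᴮ_ F → Additive _+ᴬ_ _+ᴮ_ G → Additive _+ᴬ_ _+ᴮ_ (λ x → F x +ᴮ G x)
  additive-+ interchange {F} {G} F-+ G-+ x y =
    trans (cong₂ _+ᴮ_ (F-+ x y) (G-+ x y)) (interchange (F x) (F y) (G x) (G y))

  additive-∘ : {C : Set} (_+ᶜ_ : Op₂ C) {G : B → C} {F : A → B} →
    Additive _+ᴮ_ _+ᶜ_ G → Additive _+ᴬ_ _+ᴮ_ F → Additive _+ᴬ_ _+ᶜ_ (λ x → G (F x))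
  additive-∘ _+ᶜ_ {G} {F} G-+ F-+ x y = trans (cong G (F-+ x y)) (G-+ (F x) (F y))

module _ {A : Set} (_∙_ : Op₂ A) where

  zipWithⁿ-assoc : Associative _≡_ _∙_ → ∀ n → Associative _≡_ (zipWithⁿ _∙_ n)
  zipWithⁿ-assoc assoc 0 _ _ _ = refl
  zipWithⁿ-assoc assoc 1 = assoc
  zipWithⁿ-assoc assoc (suc n@(suc _)) (x , xs) (y , ys) (z , zs) =
    cong₂ _,_ (assoc x y z) (zipWithⁿ-assoc assoc n xs ys zs)

  zipWithⁿ-comm : Commutative _≡_ _∙_ → ∀ n → Commutative _≡_ (zipWithⁿ _∙_ n)
  zipWithⁿ-comm comm 0 _ _ = refl
  zipWithⁿ-comm comm 1 = comm
  zipWithⁿ-comm comm (suc n@(suc _)) (x , xs) (y , ys) =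
    cong₂ _,_ (comm x y) (zipWithⁿ-comm comm n xs ys)

  zipWithⁿ-identityʳ : ∀ {ε} → RightIdentity _≡_ ε _∙_ →
    ∀ n → RightIdentity _≡_ (replicateⁿ n ε) (zipWithⁿ _∙_ n)
  zipWithⁿ-identityʳ identityʳ 0 _ = refl
  zipWithⁿ-identityʳ identityʳ 1 = identityʳ
  zipWithⁿ-identityʳ identityʳ (suc n@(suc _)) (x , xs) =
    cong₂ _,_ (identityʳ x) (zipWithⁿ-identityʳ identityʳ n xs)

  zipWithⁿ-tabulateⁿ : ∀ n (g h : Fin n → A) →
    tabulateⁿ n (λ c → g c ∙ h c) ≡ zipWithⁿ _∙_ n (tabulateⁿ n g) (tabulateⁿ n h)
  zipWithⁿ-tabulateⁿ 0 g h = refl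
  zipWithⁿ-tabulateⁿ 1 g h = refl
  zipWithⁿ-tabulateⁿ (suc n@(suc _)) g h =
    cong (g zero ∙ h zero ,_) (zipWithⁿ-tabulateⁿ n (g ∘ suc) (h ∘ suc))

+₃-assoc : Associative _≡_ _+₃_
+₃-assoc 𝟘 y z = refl
+₃-assoc 𝟙 𝟘 z = refl
+₃-assoc 𝟙 𝟙 𝟘 = refl
+₃-assoc 𝟙 𝟙 𝟙 = refl
+₃-assoc 𝟙 𝟙 𝟚 = refl
+₃-assoc 𝟙 𝟚 𝟘 = refl
+₃-assoc 𝟙 𝟚 𝟙 = refl
+₃-assoc 𝟙 𝟚 𝟚 = refl
+₃-assoc 𝟚 𝟘 z = refl
+₃-assoc 𝟚 𝟙 𝟘 = refl
+₃-assoc 𝟚 𝟙 𝟙 = refl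
+₃-assoc 𝟚 𝟙 𝟚 = refl
+₃-assoc 𝟚 𝟚 𝟘 = refl
+₃-assoc 𝟚 𝟚 𝟙 = refl
+₃-assoc 𝟚 𝟚 𝟚 = refl

+₃-identityʳ : RightIdentity _≡_ 𝟘 _+₃_
+₃-identityʳ 𝟘 = refl
+₃-identityʳ 𝟙 = refl
+₃-identityʳ 𝟚 = refl

+₃-comm : Commutative _≡_ _+₃_
+₃-comm 𝟘 y = sym (+₃-identityʳ y)
+₃-comm 𝟙 𝟘 = refl
+₃-comm 𝟙 𝟙 = refl
+₃-comm 𝟙 𝟚 = refl
+₃-comm 𝟚 𝟘 = refl
+₃-comm 𝟚 𝟙 = refl
+₃-comm 𝟚 𝟚 = refl

-₃-distrib-+₃ : ∀ x y → -₃ (x +₃ y) ≡ -₃ x +₃ -₃ y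
-₃-distrib-+₃ 𝟘 y = refl
-₃-distrib-+₃ 𝟙 𝟘 = refl
-₃-distrib-+₃ 𝟙 𝟙 = refl
-₃-distrib-+₃ 𝟙 𝟚 = refl
-₃-distrib-+₃ 𝟚 𝟘 = refl
-₃-distrib-+₃ 𝟚 𝟙 = refl
-₃-distrib-+₃ 𝟚 𝟚 = refl

*₃-distribˡ-+₃ : ∀ x y z → x *₃ (y +₃ z) ≡ x *₃ y +₃ x *₃ z
*₃-distribˡ-+₃ 𝟘 y z = refl
*₃-distribˡ-+₃ 𝟙 y z = refl
*₃-distribˡ-+₃ 𝟚 y z = -₃-distrib-+₃ y z

*₃-distribʳ-+₃ : ∀ x y z → (x +₃ y) *₃ z ≡ x *₃ z +₃ y *₃ z
*₃-distribʳ-+₃ 𝟘 y z = refl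
*₃-distribʳ-+₃ x 𝟘 z = trans (cong (_*₃ z) (+₃-identityʳ x)) (sym (+₃-identityʳ (x *₃ z)))
*₃-distribʳ-+₃ 𝟙 𝟙 𝟘 = refl
*₃-distribʳ-+₃ 𝟙 𝟙 𝟙 = refl
*₃-distribʳ-+₃ 𝟙 𝟙 𝟚 = refl
*₃-distribʳ-+₃ 𝟙 𝟚 𝟘 = refl
*₃-distribʳ-+₃ 𝟙 𝟚 𝟙 = refl
*₃-distribʳ-+₃ 𝟙 𝟚 𝟚 = refl
*₃-distribʳ-+₃ 𝟚 𝟙 𝟘 = refl
*₃-distribʳ-+₃ 𝟚 𝟙 𝟙 = refl
*₃-distribʳ-+₃ 𝟚 𝟙 𝟚 = refl
*₃-distribʳ-+₃ 𝟚 𝟚 𝟘 = refl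
*₃-distribʳ-+₃ 𝟚 𝟚 𝟙 = refl
*₃-distribʳ-+₃ 𝟚 𝟚 𝟚 = refl

module +₃ = CommutativeSemigroupProperties (≡-commutativeSemigroup _+₃_ +₃-assoc +₃-comm)

sum3-cong : ∀ {g h : Fin 3 → F3} → g ≗ h → sum3 g ≡ sum3 h
sum3-cong g≗h = cong₂ _+₃_ (cong₂ _+₃_ (g≗h zero) (g≗h (suc zero))) (g≗h (suc (suc zero)))

sum3-+₃ : ∀ (g h : Fin 3 → F3) → sum3 (λ k → g k +₃ h k) ≡ sum3 g +₃ sum3 h
sum3-+₃ g h =
  trans (cong (_+₃ (g₂ +₃ h₂)) (+₃.interchange g₀ h₀ g₁ h₁)) (+₃.interchange (g₀ +₃ g₁) (h₀ +₃ h₁) g₂ h₂)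
  where
  g₀ g₁ g₂ h₀ h₁ h₂ : F3
  g₀ = g zero
  g₁ = g (suc zero)
  g₂ = g (suc (suc zero))
  h₀ = h zero
  h₁ = h (suc zero)
  h₂ = h (suc (suc zero))

double-sum3-+₃ : ∀ (g h : Fin 3 → Fin 3 → F3) →
  sum3 (λ k → sum3 λ l → g k l +₃ h k l) ≡ sum3 (λ k → sum3 (g k)) +₃ sum3 (λ k → sum3 (h k))
double-sum3-+₃ g h =
  trans (sum3-cong (λ k → sum3-+₃ (g k) (h k))) (sum3-+₃ (λ k → sum3 (g k)) (λ k → sum3 (h k)))

coef-toM : ∀ g i j → coef (toM g) i j ≡ g i j
coef-toM g i j =
  trans (cong (λ row → lookup row j) (lookup∘tabulate (λ i → tabulate (g i)) i)) (lookup∘tabulate (g i) j)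

toM-coef : ∀ a → toM (coef a) ≡ a
toM-coef a = trans (tabulate-cong (λ i → tabulate∘lookup (lookup a i))) (tabulate∘lookup a)

M-ext : ∀ {a b} → (∀ i j → coef a i j ≡ coef b i j) → a ≡ b
M-ext {a} {b} a≐b = begin
  a              ≡⟨ toM-coef a ⟨
  toM (coef a)   ≡⟨ tabulate-cong (λ i → tabulate-cong (a≐b i)) ⟩
  toM (coef b)   ≡⟨ toM-coef b ⟩
  b              ∎

coef-+M : ∀ a b i j → coef (a +M b) i j ≡ coef a i j +₃ coef b i j
coef-+M a b = coef-toM (λ i j → coef a i j +₃ coef b i j)

coef--M : ∀ a i j → coef (-M a) i j ≡ -₃ coef a i j
coef--M a = coef-toM (λ i j → -₃ coef a i j)

coef-·M : ∀ x a i j → coef (x ·M a) i j ≡ x *₃ coef a i j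
coef-·M x a = coef-toM (λ i j → x *₃ coef a i j)

coef-*M : ∀ a b i j → coef (a *M b) i j ≡ sum3 λ k → sum3 λ l → coef a k l *₃ coef b (i ⊖ k) (j ⊖ l)
coef-*M a b = coef-toM (λ i j → sum3 λ k → sum3 λ l → coef a k l *₃ coef b (i ⊖ k) (j ⊖ l))

+M-assoc : Associative _≡_ _+M_
+M-assoc a b c = M-ext λ i j → begin
  coef (a +M b +M c) i j                    ≡⟨ trans (coef-+M (a +M b) c i j) (cong (_+₃ _) (coef-+M a b i j)) ⟩
  coef a i j +₃ coef b i j +₃ coef c i j    ≡⟨ +₃-assoc (coef a i j) (coef b i j) (coef c i j) ⟩
  coef a i j +₃ (coef b i j +₃ coef c i j)  ≡⟨ trans (coef-+M a (b +M c) i j) (cong (_ +₃_) (coef-+M b c i j)) ⟨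
  coef (a +M (b +M c)) i j                  ∎

+M-comm : Commutative _≡_ _+M_
+M-comm a b = M-ext λ i j → trans (coef-+M a b i j) (trans (+₃-comm (coef a i j) (coef b i j)) (sym (coef-+M b a i j)))

+M-identityʳ : RightIdentity _≡_ 0M _+M_
+M-identityʳ a = M-ext λ i j →
  trans (coef-+M a 0M i j) (trans (cong (coef a i j +₃_) (zero-coef i j)) (+₃-identityʳ (coef a i j)))
  where
  zero-coef : ∀ i j → coef 0M i j ≡ 𝟘
  zero-coef i j =
    trans (cong (λ row → lookup row j) (lookup-replicate i (replicate 3 𝟘))) (lookup-replicate j 𝟘)

module +M = CommutativeSemigroupProperties (≡-commutativeSemigroup _+M_ +M-assoc +M-comm)

-M-distrib-+M : ∀ a b → -M (a +M b) ≡ -M a +M -M b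
-M-distrib-+M a b = M-ext λ i j → begin
  coef (-M (a +M b)) i j                    ≡⟨ trans (coef--M (a +M b) i j) (cong -₃_ (coef-+M a b i j)) ⟩
  -₃ (coef a i j +₃ coef b i j)             ≡⟨ -₃-distrib-+₃ (coef a i j) (coef b i j) ⟩
  -₃ coef a i j +₃ -₃ coef b i j
    ≡⟨ trans (coef-+M (-M a) (-M b) i j) (cong₂ _+₃_ (coef--M a i j) (coef--M b i j)) ⟨
  coef (-M a +M -M b) i j                   ∎

-M-interchange : ∀ a b c d → (a +M b) -M (c +M d) ≡ (a -M c) +M (b -M d)
-M-interchange a b c d = trans (cong (a +M b +M_) (-M-distrib-+M c d)) (+M.interchange a b (-M c) (-M d))

*M-distribˡ-+M : ∀ a → Additive _+M_ _+M_ (a *M_)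
*M-distribˡ-+M a b c = M-ext λ i j → begin
  coef (a *M (b +M c)) i j
    ≡⟨ coef-*M a (b +M c) i j ⟩
  (sum3 λ k → sum3 λ l → coef a k l *₃ coef (b +M c) (i ⊖ k) (j ⊖ l))
    ≡⟨ sum3-cong (λ k → sum3-cong λ l →
         trans (cong (coef a k l *₃_) (coef-+M b c (i ⊖ k) (j ⊖ l)))
               (*₃-distribˡ-+₃ (coef a k l) (coef b (i ⊖ k) (j ⊖ l)) (coef c (i ⊖ k) (j ⊖ l)))) ⟩
  (sum3 λ k → sum3 λ l → coef a k l *₃ coef b (i ⊖ k) (j ⊖ l) +₃ coef a k l *₃ coef c (i ⊖ k) (j ⊖ l))
    ≡⟨ double-sum3-+₃ (λ k l → coef a k l *₃ coef b (i ⊖ k) (j ⊖ l))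
                      (λ k l → coef a k l *₃ coef c (i ⊖ k) (j ⊖ l)) ⟩
  (sum3 λ k → sum3 λ l → coef a k l *₃ coef b (i ⊖ k) (j ⊖ l)) +₃
  (sum3 λ k → sum3 λ l → coef a k l *₃ coef c (i ⊖ k) (j ⊖ l))
    ≡⟨ trans (coef-+M (a *M b) (a *M c) i j) (cong₂ _+₃_ (coef-*M a b i j) (coef-*M a c i j)) ⟨
  coef (a *M b +M a *M c) i j
    ∎

·M-distribʳ-+₃ : ∀ x y a → (x +₃ y) ·M a ≡ x ·M a +M y ·M a
·M-distribʳ-+₃ x y a = M-ext λ i j → begin
  coef ((x +₃ y) ·M a) i j                  ≡⟨ coef-·M (x +₃ y) a i j ⟩
  (x +₃ y) *₃ coef a i j                    ≡⟨ *₃-distribʳ-+₃ x y (coef a i j) ⟩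
  x *₃ coef a i j +₃ y *₃ coef a i j
    ≡⟨ trans (coef-+M (x ·M a) (y ·M a) i j) (cong₂ _+₃_ (coef-·M x a i j) (coef-·M y a i j)) ⟨
  coef (x ·M a +M y ·M a) i j               ∎

_+M2_ : M2 → M2 → M2
_+M2_ = zipWithⁿ _+M_ 2

_+M4_ : M4 → M4 → M4
_+M4_ = zipWithⁿ _+M_ 4

module +M3 = CommutativeSemigroupProperties
  (≡-commutativeSemigroup _+M3_ (zipWithⁿ-assoc _+M_ +M-assoc 3) (zipWithⁿ-comm _+M_ +M-comm 3))

+M3-identityʳ : RightIdentity _≡_ 0M3 _+M3_
+M3-identityʳ = zipWithⁿ-identityʳ _+M_ {0M} +M-identityʳ 3

-- Over abstract operators s and t; with σ and τ themselves, comparing terms would make the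
-- type checker unfold Bσ and Bτ.
module Complex (s t : M → M) where

  N D : (M → M) → M → M
  N u m = m +M u m +M u (u m)
  D u m = m -M u m

  ∂¹ : M2 → M3
  ∂¹ (a , b) = N s a , (D t a -M D s b) , N t b

  ∂² : M3 → M4
  ∂² (x , y , z) = D s x , (D t x -M N s y) , (N t y +M D s z) , D t z

  N-additive : ∀ u → Additive _+M_ _+M_ u → Additive _+M_ _+M_ (N u)
  N-additive u u-+ a b = begin
    a +M b +M u (a +M b) +M u (u (a +M b))
      ≡⟨ cong₂ (λ p q → a +M b +M p +M q) (u-+ a b) (trans (cong u (u-+ a b)) (u-+ (u a) (u b))) ⟩
    a +M b +M (u a +M u b) +M (u (u a) +M u (u b))
      ≡⟨ cong (_+M (u (u a) +M u (u b))) (+M.interchange a b (u a) (u b)) ⟩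
    a +M u a +M (b +M u b) +M (u (u a) +M u (u b))
      ≡⟨ +M.interchange (a +M u a) (b +M u b) (u (u a)) (u (u b)) ⟩
    a +M u a +M u (u a) +M (b +M u b +M u (u b))
      ∎

  D-additive : ∀ u → Additive _+M_ _+M_ u → Additive _+M_ _+M_ (D u)
  D-additive u u-+ a b = trans (cong (λ m → a +M b -M m) (u-+ a b)) (-M-interchange a b (u a) (u b))

  module _ (s-+ : Additive _+M_ _+M_ s) (t-+ : Additive _+M_ _+M_ t) where

    ∂¹-additive : Additive _+M2_ _+M3_ ∂¹
    ∂¹-additive (a , b) (a′ , b′) =
      cong₂ _,_ (N-additive s s-+ a a′) (cong₂ _,_ middle (N-additive t t-+ b b′))
      where
      middle : D t (a +M a′) -M D s (b +M b′) ≡ (D t a -M D s b) +M (D t a′ -M D s b′)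
      middle = trans (cong₂ _-M_ (D-additive t t-+ a a′) (D-additive s s-+ b b′))
                     (-M-interchange (D t a) (D t a′) (D s b) (D s b′))

    ∂²-additive : Additive _+M3_ _+M4_ ∂²
    ∂²-additive (x , y , z) (x′ , y′ , z′) =
      cong₂ _,_ (D-additive s s-+ x x′) (cong₂ _,_ second (cong₂ _,_ third (D-additive t t-+ z z′)))
      where
      second : D t (x +M x′) -M N s (y +M y′) ≡ (D t x -M N s y) +M (D t x′ -M N s y′)
      second = trans (cong₂ _-M_ (D-additive t t-+ x x′) (N-additive s s-+ y y′))
                     (-M-interchange (D t x) (D t x′) (N s y) (N s y′))
      third : N t (y +M y′) +M D s (z +M z′) ≡ (N t y +M D s z) +M (N t y′ +M D s z′)
      third = trans (cong₂ _+M_ (N-additive t t-+ y y′) (D-additive s s-+ z z′))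
                    (+M.interchange (N t y) (N t y′) (D s z) (D s z′))

open Complex σ· τ· using (∂¹; ∂²; ∂¹-additive; ∂²-additive)

σ-additive : Additive _+M_ _+M_ σ·
σ-additive = additive-≗ _+M_ _+M_ {Bσ *M_} {σ·} (*M-distribˡ-+M Bσ) (λ _ → refl)

τ-additive : Additive _+M_ _+M_ τ·
τ-additive = additive-≗ _+M_ _+M_ {Bτ *M_} {τ·} (*M-distribˡ-+M Bτ) (λ _ → refl)

d1-additive : Additive _+M2_ _+M3_ d1
d1-additive =
  additive-≗ _+M2_ _+M3_ {∂¹} {d1} (∂¹-additive σ-additive τ-additive) (λ where (a , b) → refl)

d2-additive : Additive _+M3_ _+M4_ d2
d2-additive =
  additive-≗ _+M3_ _+M4_ {∂²} {d2} (∂²-additive σ-additive τ-additive) (λ where (x , y , z) → refl)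

infixl 6 _+V_

_+V_ : ∀ {n} → Op₂ (Vec F3 n)
_+V_ = zipWith _+₃_

+V-identityˡ : ∀ {n} (v : Vec F3 n) → replicate n 𝟘 +V v ≡ v
+V-identityˡ = zipWith-identityˡ {f = _+₃_} (λ _ → refl)

index : ∀ {n} → Fin n → Fin 3 → Fin 3 → Fin (n * 9)
index c i j = combine c (combine i j)

block : ∀ {n} → Vec F3 (n * 9) → Fin n → M
block v c = toM λ i j → lookup v (index c i j)

unflat : ∀ n → Vec F3 (n * 9) → M ^ n
unflat n v = tabulateⁿ n (block v)

flat : ∀ n → M ^ n → Vec F3 (n * 9)
flat n w = concat (map concat (toVec n w))

coef-block : ∀ {n} (v : Vec F3 (n * 9)) (c : Fin n) i j → coef (block v c) i j ≡ lookup v (index c i j)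
coef-block v c = coef-toM (λ i j → lookup v (index c i j))

block-additive : ∀ {n} (u v : Vec F3 (n * 9)) (c : Fin n) → block (u +V v) c ≡ block u c +M block v c
block-additive u v c = M-ext λ i j → begin
  coef (block (u +V v) c) i j               ≡⟨ coef-block (u +V v) c i j ⟩
  lookup (u +V v) (index c i j)             ≡⟨ lookup-zipWith _+₃_ (index c i j) u v ⟩
  lookup u (index c i j) +₃ lookup v (index c i j)
    ≡⟨ trans (coef-+M (block u c) (block v c) i j) (cong₂ _+₃_ (coef-block u c i j) (coef-block v c i j)) ⟨
  coef (block u c +M block v c) i j         ∎

unflat-additive : ∀ n → Additive _+V_ (zipWithⁿ _+M_ n) (unflat n)
unflat-additive n u v = begin
  tabulateⁿ n (block (u +V v))                         ≡⟨ cong fromVec (tabulate-cong (block-additive u v)) ⟩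
  tabulateⁿ n (λ c → block u c +M block v c)           ≡⟨ zipWithⁿ-tabulateⁿ _+M_ n (block u) (block v) ⟩
  zipWithⁿ _+M_ n (tabulateⁿ n (block u)) (tabulateⁿ n (block v)) ∎

block-flat : ∀ n (w : M ^ n) (c : Fin n) → block (flat n w) c ≡ lookup (toVec n w) c
block-flat n w c = M-ext λ i j → begin
  coef (block (flat n w) c) i j                          ≡⟨ coef-block {n} (flat n w) c i j ⟩
  lookup (concat (map concat ws)) (index c i j)        ≡⟨ lookup-concat (map concat ws) c (combine i j) ⟩
  lookup (lookup (map concat ws) c) (combine i j)
    ≡⟨ cong (λ xs → lookup xs (combine i j)) (lookup-map c concat ws) ⟩
  lookup (concat (lookup ws c)) (combine i j)          ≡⟨ lookup-concat (lookup ws c) i j ⟩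
  coef (lookup ws c) i j                               ∎
  where
  ws : Vec M n
  ws = toVec n w

unflat-flat : ∀ n (w : M ^ n) → unflat n (flat n w) ≡ w
unflat-flat n w = begin
  fromVec (tabulate (block (flat n w)))   ≡⟨ cong fromVec (tabulate-cong (block-flat n w)) ⟩
  fromVec (tabulate (lookup (toVec n w))) ≡⟨ cong fromVec (tabulate∘lookup (toVec n w)) ⟩
  fromVec (toVec n w)                     ≡⟨ fromVec∘toVec n w ⟩
  w                                       ∎

⟪_,_⟫ : M → M → F3
⟪ p , x ⟫ = sum3 λ i → sum3 λ j → coef p i j *₃ coef x i j

⟪,⟫-additive : ∀ p → Additive _+M_ _+₃_ ⟪ p ,_⟫
⟪,⟫-additive p x y = begin
  (sum3 λ i → sum3 λ j → coef p i j *₃ coef (x +M y) i j)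
    ≡⟨ sum3-cong (λ i → sum3-cong λ j →
         trans (cong (coef p i j *₃_) (coef-+M x y i j)) (*₃-distribˡ-+₃ (coef p i j) (coef x i j) (coef y i j))) ⟩
  (sum3 λ i → sum3 λ j → coef p i j *₃ coef x i j +₃ coef p i j *₃ coef y i j)
    ≡⟨ double-sum3-+₃ (λ i j → coef p i j *₃ coef x i j) (λ i j → coef p i j *₃ coef y i j) ⟩
  ⟪ p , x ⟫ +₃ ⟪ p , y ⟫
    ∎

pairing : ∀ n → M ^ n → M ^ n → F3
pairing 0 _ _ = 𝟘
pairing 1 p x = ⟪ p , x ⟫
pairing (suc n@(suc _)) (p , ps) (x , xs) = ⟪ p , x ⟫ +₃ pairing n ps xs

pairing-additive : ∀ n p → Additive (zipWithⁿ _+M_ n) _+₃_ (pairing n p)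
pairing-additive 0 _ _ _ = refl
pairing-additive 1 p = ⟪,⟫-additive p
pairing-additive (suc n@(suc _)) (p , ps) (x , xs) (y , ys) =
  trans (cong₂ _+₃_ (⟪,⟫-additive p x y) (pairing-additive n ps xs ys))
        (+₃.interchange ⟪ p , x ⟫ ⟪ p , y ⟫ (pairing n ps xs) (pairing n ps ys))

applyMatrix : ∀ n {m} → Vec (Vec F3 (n * 9)) m → M ^ n → Vec F3 m
applyMatrix n rows w = map (λ row → pairing n (unflat n row) w) rows

applyMatrix-additive : ∀ n {m} (rows : Vec (Vec F3 (n * 9)) m) →
  Additive (zipWithⁿ _+M_ n) _+V_ (applyMatrix n rows)
applyMatrix-additive n [] _ _ = refl
applyMatrix-additive n (row ∷ rows) x y =
  cong₂ _∷_ (pairing-additive n (unflat n row) x y) (applyMatrix-additive n rows x y)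

·M3-distribʳ-+₃ : ∀ x y w → (x +₃ y) ·M3 w ≡ (x ·M3 w) +M3 (y ·M3 w)
·M3-distribʳ-+₃ x y (a , b , c) =
  cong₂ _,_ (·M-distribʳ-+₃ x y a) (cong₂ _,_ (·M-distribʳ-+₃ x y b) (·M-distribʳ-+₃ x y c))

lincomb-additive : ∀ {n} (ws : Vec M3 n) → Additive _+V_ _+M3_ (λ c → lincomb c ws)
lincomb-additive [] [] [] = refl
lincomb-additive (w ∷ ws) (x ∷ c) (y ∷ c′) =
  trans (cong₂ _+M3_ (·M3-distribʳ-+₃ x y w) (lincomb-additive ws c c′))
        (+M3.interchange (x ·M3 w) (y ·M3 w) (lincomb c ws) (lincomb c′ ws))

unit : ∀ {n} → Fin n → Vec F3 n
unit zero = 𝟙 ∷ replicate _ 𝟘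
unit (suc k) = 𝟘 ∷ unit k

module _ {Y : Set} (_⊕_ : Op₂ Y) where

  additive-unique : ∀ {n} (F G : Vec F3 n → Y) → Additive _+V_ _⊕_ F → Additive _+V_ _⊕_ G →
    F (replicate n 𝟘) ≡ G (replicate n 𝟘) → (∀ k → F (unit k) ≡ G (unit k)) → F ≗ G
  additive-unique F G _ _ F0≡G0 _ [] = F0≡G0
  additive-unique {suc n} F G F-+ G-+ F0≡G0 F≡G-on-units (x ∷ v) = begin
    F (x ∷ v)                    ≡⟨ cong F (split x) ⟩
    F ((x ∷ 0s) +V (𝟘 ∷ v))      ≡⟨ F-+ (x ∷ 0s) (𝟘 ∷ v) ⟩
    F (x ∷ 0s) ⊕ F (𝟘 ∷ v)       ≡⟨ cong₂ _⊕_ (on-head x) on-tail ⟩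
    G (x ∷ 0s) ⊕ G (𝟘 ∷ v)       ≡⟨ G-+ (x ∷ 0s) (𝟘 ∷ v) ⟨
    G ((x ∷ 0s) +V (𝟘 ∷ v))      ≡⟨ cong G (split x) ⟨
    G (x ∷ v)                    ∎
    where
    0s : Vec F3 n
    0s = replicate n 𝟘

    split : ∀ x → x ∷ v ≡ (x ∷ 0s) +V (𝟘 ∷ v)
    split x = cong₂ _∷_ (sym (+₃-identityʳ x)) (sym (+V-identityˡ v))

    on-tail : F (𝟘 ∷ v) ≡ G (𝟘 ∷ v)
    on-tail = additive-unique (F ∘ (𝟘 ∷_)) (G ∘ (𝟘 ∷_))
      (λ u w → F-+ (𝟘 ∷ u) (𝟘 ∷ w)) (λ u w → G-+ (𝟘 ∷ u) (𝟘 ∷ w))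
      F0≡G0 (F≡G-on-units ∘ suc) v

    twice : 𝟚 ∷ 0s ≡ (𝟙 ∷ 0s) +V (𝟙 ∷ 0s)
    twice = cong (𝟚 ∷_) (sym (+V-identityˡ 0s))

    on-head : ∀ x → F (x ∷ 0s) ≡ G (x ∷ 0s)
    on-head 𝟘 = F0≡G0
    on-head 𝟙 = F≡G-on-units zero
    on-head 𝟚 = begin
      F (𝟚 ∷ 0s)                   ≡⟨ trans (cong F twice) (F-+ (𝟙 ∷ 0s) (𝟙 ∷ 0s)) ⟩
      F (𝟙 ∷ 0s) ⊕ F (𝟙 ∷ 0s)      ≡⟨ cong₂ _⊕_ (F≡G-on-units zero) (F≡G-on-units zero) ⟩
      G (𝟙 ∷ 0s) ⊕ G (𝟙 ∷ 0s)      ≡⟨ trans (cong G twice) (G-+ (𝟙 ∷ 0s) (𝟙 ∷ 0s)) ⟨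
      G (𝟚 ∷ 0s)                   ∎

  additive-uniqueⁿ : ∀ n (F G : M ^ n → Y) →
    Additive (zipWithⁿ _+M_ n) _⊕_ F → Additive (zipWithⁿ _+M_ n) _⊕_ G →
    F (unflat n (replicate _ 𝟘)) ≡ G (unflat n (replicate _ 𝟘)) →
    (∀ k → F (unflat n (unit k)) ≡ G (unflat n (unit k))) → F ≗ G
  additive-uniqueⁿ n F G F-+ G-+ F0≡G0 F≡G-on-units w = begin
    F w                       ≡⟨ cong F (unflat-flat n w) ⟨
    F (unflat n (flat n w))   ≡⟨ additive-unique (F ∘ unflat n) (G ∘ unflat n)
                                   (additive-∘ _+V_ _ _⊕_ F-+ (unflat-additive n))
                                   (additive-∘ _+V_ _ _⊕_ G-+ (unflat-additive n))
                                   F0≡G0 F≡G-on-units (flat n w) ⟩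
    G (unflat n (flat n w))   ≡⟨ cong G (unflat-flat n w) ⟩
    G w                       ∎

_≟₃_ : DecidableEquality F3
𝟘 ≟₃ 𝟘 = yes refl
𝟙 ≟₃ 𝟙 = yes refl
𝟚 ≟₃ 𝟚 = yes refl
𝟘 ≟₃ 𝟙 = no λ ()
𝟘 ≟₃ 𝟚 = no λ ()
𝟙 ≟₃ 𝟘 = no λ ()
𝟙 ≟₃ 𝟚 = no λ ()
𝟚 ≟₃ 𝟘 = no λ ()
𝟚 ≟₃ 𝟙 = no λ ()

_≟M_ : DecidableEquality M
_≟M_ = Vec.≡-dec (Vec.≡-dec _≟₃_)

≟ⁿ : ∀ n → DecidableEquality (M ^ n)
≟ⁿ 0 _ _ = yes refl
≟ⁿ 1 = _≟M_
≟ⁿ (suc n@(suc _)) = Product.≡-dec _≟M_ (≟ⁿ n)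

-- Row r of a matrix lists, at position 9c + 3i + j, the coefficient of e^i f^j in the
-- c-th component.  The three matrices were computed by linear algebra over 𝔽₃; the only
-- thing used about them is the identity checked in splitting-identity below.

coordinate-rows : Vec (Vec F3 27) 13
coordinate-rows =
  ( 𝟘 ∷ 𝟘 ∷ 𝟘 ∷ 𝟘 ∷ 𝟘 ∷ 𝟘 ∷ 𝟚 ∷ 𝟙 ∷ 𝟘 ∷ 𝟘 ∷ 𝟘 ∷ 𝟘 ∷ 𝟘 ∷ 𝟘 ∷ 𝟘 ∷ 𝟘 ∷ 𝟘 ∷ 𝟘 ∷ 𝟘 ∷ 𝟘 ∷ 𝟘 ∷ 𝟘 ∷ 𝟘 ∷ 𝟘 ∷ 𝟘 ∷ 𝟘 ∷ 𝟘 ∷ [])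
  ∷ (𝟘 ∷ 𝟘 ∷ 𝟘 ∷ 𝟘 ∷ 𝟘 ∷ 𝟘 ∷ 𝟚 ∷ 𝟘 ∷ 𝟙 ∷ 𝟘 ∷ 𝟘 ∷ 𝟘 ∷ 𝟘 ∷ 𝟘 ∷ 𝟘 ∷ 𝟘 ∷ 𝟘 ∷ 𝟘 ∷ 𝟘 ∷ 𝟘 ∷ 𝟘 ∷ 𝟘 ∷ 𝟘 ∷ 𝟘 ∷ 𝟘 ∷ 𝟘 ∷ 𝟘 ∷ [])
  ∷ (𝟘 ∷ 𝟘 ∷ 𝟚 ∷ 𝟘 ∷ 𝟘 ∷ 𝟙 ∷ 𝟘 ∷ 𝟘 ∷ 𝟘 ∷ 𝟘 ∷ 𝟘 ∷ 𝟘 ∷ 𝟘 ∷ 𝟘 ∷ 𝟘 ∷ 𝟘 ∷ 𝟘 ∷ 𝟘 ∷ 𝟘 ∷ 𝟘 ∷ 𝟘 ∷ 𝟘 ∷ 𝟘 ∷ 𝟘 ∷ 𝟘 ∷ 𝟘 ∷ 𝟘 ∷ [])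
  ∷ (𝟘 ∷ 𝟘 ∷ 𝟚 ∷ 𝟘 ∷ 𝟘 ∷ 𝟘 ∷ 𝟘 ∷ 𝟘 ∷ 𝟙 ∷ 𝟘 ∷ 𝟘 ∷ 𝟘 ∷ 𝟘 ∷ 𝟘 ∷ 𝟘 ∷ 𝟘 ∷ 𝟘 ∷ 𝟘 ∷ 𝟘 ∷ 𝟘 ∷ 𝟘 ∷ 𝟘 ∷ 𝟘 ∷ 𝟘 ∷ 𝟘 ∷ 𝟘 ∷ 𝟘 ∷ [])
  ∷ (𝟘 ∷ 𝟘 ∷ 𝟘 ∷ 𝟘 ∷ 𝟘 ∷ 𝟘 ∷ 𝟘 ∷ 𝟘 ∷ 𝟘 ∷ 𝟘 ∷ 𝟘 ∷ 𝟘 ∷ 𝟚 ∷ 𝟚 ∷ 𝟚 ∷ 𝟚 ∷ 𝟚 ∷ 𝟚 ∷ 𝟘 ∷ 𝟘 ∷ 𝟘 ∷ 𝟘 ∷ 𝟘 ∷ 𝟘 ∷ 𝟘 ∷ 𝟘 ∷ 𝟘 ∷ [])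
  ∷ (𝟘 ∷ 𝟘 ∷ 𝟘 ∷ 𝟘 ∷ 𝟘 ∷ 𝟘 ∷ 𝟘 ∷ 𝟘 ∷ 𝟘 ∷ 𝟘 ∷ 𝟘 ∷ 𝟘 ∷ 𝟙 ∷ 𝟙 ∷ 𝟙 ∷ 𝟘 ∷ 𝟘 ∷ 𝟘 ∷ 𝟘 ∷ 𝟘 ∷ 𝟘 ∷ 𝟘 ∷ 𝟘 ∷ 𝟘 ∷ 𝟘 ∷ 𝟘 ∷ 𝟘 ∷ [])
  ∷ (𝟘 ∷ 𝟘 ∷ 𝟘 ∷ 𝟘 ∷ 𝟘 ∷ 𝟘 ∷ 𝟘 ∷ 𝟘 ∷ 𝟘 ∷ 𝟘 ∷ 𝟚 ∷ 𝟚 ∷ 𝟘 ∷ 𝟚 ∷ 𝟚 ∷ 𝟘 ∷ 𝟚 ∷ 𝟚 ∷ 𝟘 ∷ 𝟘 ∷ 𝟘 ∷ 𝟘 ∷ 𝟘 ∷ 𝟘 ∷ 𝟘 ∷ 𝟘 ∷ 𝟘 ∷ [])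
  ∷ (𝟘 ∷ 𝟘 ∷ 𝟘 ∷ 𝟘 ∷ 𝟘 ∷ 𝟘 ∷ 𝟘 ∷ 𝟘 ∷ 𝟘 ∷ 𝟘 ∷ 𝟙 ∷ 𝟘 ∷ 𝟘 ∷ 𝟙 ∷ 𝟘 ∷ 𝟘 ∷ 𝟙 ∷ 𝟘 ∷ 𝟘 ∷ 𝟘 ∷ 𝟘 ∷ 𝟘 ∷ 𝟘 ∷ 𝟘 ∷ 𝟘 ∷ 𝟘 ∷ 𝟘 ∷ [])
  ∷ (𝟘 ∷ 𝟘 ∷ 𝟘 ∷ 𝟘 ∷ 𝟘 ∷ 𝟘 ∷ 𝟘 ∷ 𝟘 ∷ 𝟘 ∷ 𝟘 ∷ 𝟘 ∷ 𝟘 ∷ 𝟘 ∷ 𝟘 ∷ 𝟘 ∷ 𝟘 ∷ 𝟘 ∷ 𝟘 ∷ 𝟘 ∷ 𝟘 ∷ 𝟙 ∷ 𝟘 ∷ 𝟘 ∷ 𝟘 ∷ 𝟙 ∷ 𝟘 ∷ 𝟚 ∷ [])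
  ∷ (𝟘 ∷ 𝟘 ∷ 𝟘 ∷ 𝟘 ∷ 𝟘 ∷ 𝟘 ∷ 𝟘 ∷ 𝟘 ∷ 𝟘 ∷ 𝟘 ∷ 𝟘 ∷ 𝟘 ∷ 𝟘 ∷ 𝟘 ∷ 𝟘 ∷ 𝟘 ∷ 𝟘 ∷ 𝟘 ∷ 𝟘 ∷ 𝟘 ∷ 𝟙 ∷ 𝟘 ∷ 𝟘 ∷ 𝟘 ∷ 𝟘 ∷ 𝟙 ∷ 𝟚 ∷ [])
  ∷ (𝟘 ∷ 𝟘 ∷ 𝟘 ∷ 𝟘 ∷ 𝟘 ∷ 𝟘 ∷ 𝟘 ∷ 𝟘 ∷ 𝟘 ∷ 𝟘 ∷ 𝟘 ∷ 𝟘 ∷ 𝟘 ∷ 𝟘 ∷ 𝟘 ∷ 𝟘 ∷ 𝟘 ∷ 𝟘 ∷ 𝟘 ∷ 𝟘 ∷ 𝟙 ∷ 𝟘 ∷ 𝟘 ∷ 𝟘 ∷ 𝟘 ∷ 𝟘 ∷ 𝟘 ∷ [])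
  ∷ (𝟘 ∷ 𝟘 ∷ 𝟘 ∷ 𝟘 ∷ 𝟘 ∷ 𝟘 ∷ 𝟘 ∷ 𝟘 ∷ 𝟘 ∷ 𝟘 ∷ 𝟘 ∷ 𝟘 ∷ 𝟘 ∷ 𝟘 ∷ 𝟘 ∷ 𝟘 ∷ 𝟘 ∷ 𝟘 ∷ 𝟘 ∷ 𝟘 ∷ 𝟘 ∷ 𝟘 ∷ 𝟘 ∷ 𝟙 ∷ 𝟙 ∷ 𝟘 ∷ 𝟚 ∷ [])
  ∷ (𝟘 ∷ 𝟘 ∷ 𝟘 ∷ 𝟘 ∷ 𝟘 ∷ 𝟘 ∷ 𝟘 ∷ 𝟘 ∷ 𝟘 ∷ 𝟘 ∷ 𝟘 ∷ 𝟘 ∷ 𝟘 ∷ 𝟘 ∷ 𝟘 ∷ 𝟘 ∷ 𝟘 ∷ 𝟘 ∷ 𝟘 ∷ 𝟘 ∷ 𝟘 ∷ 𝟘 ∷ 𝟘 ∷ 𝟘 ∷ 𝟙 ∷ 𝟘 ∷ 𝟘 ∷ [])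
  ∷ []

h²-rows : Vec (Vec F3 27) 18
h²-rows =
  ( 𝟘 ∷ 𝟘 ∷ 𝟚 ∷ 𝟘 ∷ 𝟘 ∷ 𝟘 ∷ 𝟚 ∷ 𝟘 ∷ 𝟙 ∷ 𝟘 ∷ 𝟚 ∷ 𝟙 ∷ 𝟚 ∷ 𝟚 ∷ 𝟙 ∷ 𝟙 ∷ 𝟙 ∷ 𝟙 ∷ 𝟘 ∷ 𝟘 ∷ 𝟘 ∷ 𝟘 ∷ 𝟘 ∷ 𝟘 ∷ 𝟘 ∷ 𝟘 ∷ 𝟘 ∷ [])
  ∷ (𝟘 ∷ 𝟘 ∷ 𝟚 ∷ 𝟘 ∷ 𝟘 ∷ 𝟘 ∷ 𝟚 ∷ 𝟘 ∷ 𝟙 ∷ 𝟘 ∷ 𝟙 ∷ 𝟚 ∷ 𝟙 ∷ 𝟙 ∷ 𝟚 ∷ 𝟚 ∷ 𝟚 ∷ 𝟚 ∷ 𝟘 ∷ 𝟘 ∷ 𝟘 ∷ 𝟘 ∷ 𝟘 ∷ 𝟘 ∷ 𝟘 ∷ 𝟘 ∷ 𝟘 ∷ [])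
  ∷ (𝟘 ∷ 𝟘 ∷ 𝟘 ∷ 𝟘 ∷ 𝟘 ∷ 𝟘 ∷ 𝟘 ∷ 𝟘 ∷ 𝟘 ∷ 𝟘 ∷ 𝟘 ∷ 𝟘 ∷ 𝟘 ∷ 𝟘 ∷ 𝟘 ∷ 𝟘 ∷ 𝟘 ∷ 𝟘 ∷ 𝟘 ∷ 𝟘 ∷ 𝟘 ∷ 𝟘 ∷ 𝟘 ∷ 𝟘 ∷ 𝟘 ∷ 𝟘 ∷ 𝟘 ∷ [])
  ∷ (𝟘 ∷ 𝟘 ∷ 𝟘 ∷ 𝟘 ∷ 𝟘 ∷ 𝟘 ∷ 𝟘 ∷ 𝟘 ∷ 𝟘 ∷ 𝟘 ∷ 𝟘 ∷ 𝟘 ∷ 𝟘 ∷ 𝟘 ∷ 𝟘 ∷ 𝟘 ∷ 𝟘 ∷ 𝟘 ∷ 𝟘 ∷ 𝟘 ∷ 𝟘 ∷ 𝟘 ∷ 𝟘 ∷ 𝟘 ∷ 𝟘 ∷ 𝟘 ∷ 𝟘 ∷ [])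
  ∷ (𝟘 ∷ 𝟘 ∷ 𝟘 ∷ 𝟘 ∷ 𝟘 ∷ 𝟘 ∷ 𝟘 ∷ 𝟘 ∷ 𝟘 ∷ 𝟘 ∷ 𝟘 ∷ 𝟘 ∷ 𝟘 ∷ 𝟘 ∷ 𝟘 ∷ 𝟘 ∷ 𝟘 ∷ 𝟘 ∷ 𝟘 ∷ 𝟘 ∷ 𝟘 ∷ 𝟘 ∷ 𝟘 ∷ 𝟘 ∷ 𝟘 ∷ 𝟘 ∷ 𝟘 ∷ [])
  ∷ (𝟘 ∷ 𝟘 ∷ 𝟘 ∷ 𝟘 ∷ 𝟘 ∷ 𝟘 ∷ 𝟘 ∷ 𝟘 ∷ 𝟘 ∷ 𝟘 ∷ 𝟘 ∷ 𝟘 ∷ 𝟘 ∷ 𝟘 ∷ 𝟘 ∷ 𝟘 ∷ 𝟘 ∷ 𝟘 ∷ 𝟘 ∷ 𝟘 ∷ 𝟘 ∷ 𝟘 ∷ 𝟘 ∷ 𝟘 ∷ 𝟘 ∷ 𝟘 ∷ 𝟘 ∷ [])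
  ∷ (𝟘 ∷ 𝟘 ∷ 𝟘 ∷ 𝟘 ∷ 𝟘 ∷ 𝟘 ∷ 𝟘 ∷ 𝟘 ∷ 𝟘 ∷ 𝟘 ∷ 𝟘 ∷ 𝟘 ∷ 𝟘 ∷ 𝟘 ∷ 𝟘 ∷ 𝟘 ∷ 𝟘 ∷ 𝟘 ∷ 𝟘 ∷ 𝟘 ∷ 𝟘 ∷ 𝟘 ∷ 𝟘 ∷ 𝟘 ∷ 𝟘 ∷ 𝟘 ∷ 𝟘 ∷ [])
  ∷ (𝟘 ∷ 𝟘 ∷ 𝟘 ∷ 𝟘 ∷ 𝟘 ∷ 𝟘 ∷ 𝟘 ∷ 𝟘 ∷ 𝟘 ∷ 𝟘 ∷ 𝟘 ∷ 𝟘 ∷ 𝟘 ∷ 𝟘 ∷ 𝟘 ∷ 𝟘 ∷ 𝟘 ∷ 𝟘 ∷ 𝟘 ∷ 𝟘 ∷ 𝟘 ∷ 𝟘 ∷ 𝟘 ∷ 𝟘 ∷ 𝟘 ∷ 𝟘 ∷ 𝟘 ∷ [])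
  ∷ (𝟘 ∷ 𝟘 ∷ 𝟘 ∷ 𝟘 ∷ 𝟘 ∷ 𝟘 ∷ 𝟘 ∷ 𝟘 ∷ 𝟘 ∷ 𝟘 ∷ 𝟘 ∷ 𝟘 ∷ 𝟘 ∷ 𝟘 ∷ 𝟘 ∷ 𝟘 ∷ 𝟘 ∷ 𝟘 ∷ 𝟘 ∷ 𝟘 ∷ 𝟘 ∷ 𝟘 ∷ 𝟘 ∷ 𝟘 ∷ 𝟘 ∷ 𝟘 ∷ 𝟘 ∷ [])
  ∷ (𝟘 ∷ 𝟘 ∷ 𝟚 ∷ 𝟘 ∷ 𝟘 ∷ 𝟘 ∷ 𝟚 ∷ 𝟘 ∷ 𝟙 ∷ 𝟘 ∷ 𝟘 ∷ 𝟚 ∷ 𝟘 ∷ 𝟚 ∷ 𝟚 ∷ 𝟚 ∷ 𝟚 ∷ 𝟚 ∷ 𝟘 ∷ 𝟘 ∷ 𝟘 ∷ 𝟘 ∷ 𝟘 ∷ 𝟘 ∷ 𝟘 ∷ 𝟘 ∷ 𝟘 ∷ [])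
  ∷ (𝟘 ∷ 𝟘 ∷ 𝟚 ∷ 𝟘 ∷ 𝟘 ∷ 𝟘 ∷ 𝟚 ∷ 𝟘 ∷ 𝟙 ∷ 𝟘 ∷ 𝟙 ∷ 𝟘 ∷ 𝟘 ∷ 𝟚 ∷ 𝟘 ∷ 𝟘 ∷ 𝟘 ∷ 𝟘 ∷ 𝟘 ∷ 𝟘 ∷ 𝟘 ∷ 𝟘 ∷ 𝟘 ∷ 𝟘 ∷ 𝟘 ∷ 𝟘 ∷ 𝟘 ∷ [])
  ∷ (𝟘 ∷ 𝟘 ∷ 𝟘 ∷ 𝟘 ∷ 𝟘 ∷ 𝟘 ∷ 𝟘 ∷ 𝟘 ∷ 𝟘 ∷ 𝟘 ∷ 𝟘 ∷ 𝟘 ∷ 𝟘 ∷ 𝟘 ∷ 𝟘 ∷ 𝟘 ∷ 𝟘 ∷ 𝟘 ∷ 𝟘 ∷ 𝟘 ∷ 𝟘 ∷ 𝟘 ∷ 𝟘 ∷ 𝟘 ∷ 𝟘 ∷ 𝟘 ∷ 𝟘 ∷ [])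
  ∷ (𝟘 ∷ 𝟘 ∷ 𝟚 ∷ 𝟘 ∷ 𝟘 ∷ 𝟘 ∷ 𝟚 ∷ 𝟘 ∷ 𝟙 ∷ 𝟘 ∷ 𝟘 ∷ 𝟘 ∷ 𝟙 ∷ 𝟚 ∷ 𝟘 ∷ 𝟘 ∷ 𝟘 ∷ 𝟘 ∷ 𝟘 ∷ 𝟘 ∷ 𝟘 ∷ 𝟘 ∷ 𝟘 ∷ 𝟘 ∷ 𝟘 ∷ 𝟘 ∷ 𝟘 ∷ [])
  ∷ (𝟘 ∷ 𝟘 ∷ 𝟘 ∷ 𝟘 ∷ 𝟘 ∷ 𝟘 ∷ 𝟘 ∷ 𝟘 ∷ 𝟘 ∷ 𝟘 ∷ 𝟘 ∷ 𝟘 ∷ 𝟘 ∷ 𝟘 ∷ 𝟘 ∷ 𝟘 ∷ 𝟘 ∷ 𝟘 ∷ 𝟘 ∷ 𝟘 ∷ 𝟘 ∷ 𝟘 ∷ 𝟘 ∷ 𝟘 ∷ 𝟘 ∷ 𝟘 ∷ 𝟘 ∷ [])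
  ∷ (𝟘 ∷ 𝟘 ∷ 𝟘 ∷ 𝟘 ∷ 𝟘 ∷ 𝟘 ∷ 𝟘 ∷ 𝟘 ∷ 𝟘 ∷ 𝟘 ∷ 𝟘 ∷ 𝟘 ∷ 𝟘 ∷ 𝟘 ∷ 𝟘 ∷ 𝟘 ∷ 𝟘 ∷ 𝟘 ∷ 𝟘 ∷ 𝟘 ∷ 𝟘 ∷ 𝟘 ∷ 𝟘 ∷ 𝟘 ∷ 𝟘 ∷ 𝟘 ∷ 𝟘 ∷ [])
  ∷ (𝟘 ∷ 𝟘 ∷ 𝟘 ∷ 𝟘 ∷ 𝟘 ∷ 𝟘 ∷ 𝟘 ∷ 𝟘 ∷ 𝟘 ∷ 𝟘 ∷ 𝟘 ∷ 𝟘 ∷ 𝟘 ∷ 𝟘 ∷ 𝟘 ∷ 𝟘 ∷ 𝟘 ∷ 𝟘 ∷ 𝟘 ∷ 𝟘 ∷ 𝟘 ∷ 𝟘 ∷ 𝟘 ∷ 𝟘 ∷ 𝟘 ∷ 𝟘 ∷ 𝟘 ∷ [])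
  ∷ (𝟘 ∷ 𝟘 ∷ 𝟘 ∷ 𝟘 ∷ 𝟘 ∷ 𝟘 ∷ 𝟘 ∷ 𝟘 ∷ 𝟘 ∷ 𝟘 ∷ 𝟘 ∷ 𝟘 ∷ 𝟘 ∷ 𝟘 ∷ 𝟘 ∷ 𝟘 ∷ 𝟘 ∷ 𝟘 ∷ 𝟘 ∷ 𝟘 ∷ 𝟘 ∷ 𝟘 ∷ 𝟘 ∷ 𝟘 ∷ 𝟘 ∷ 𝟘 ∷ 𝟘 ∷ [])
  ∷ (𝟘 ∷ 𝟘 ∷ 𝟘 ∷ 𝟘 ∷ 𝟘 ∷ 𝟘 ∷ 𝟘 ∷ 𝟘 ∷ 𝟘 ∷ 𝟘 ∷ 𝟘 ∷ 𝟘 ∷ 𝟘 ∷ 𝟘 ∷ 𝟘 ∷ 𝟘 ∷ 𝟘 ∷ 𝟘 ∷ 𝟘 ∷ 𝟘 ∷ 𝟘 ∷ 𝟘 ∷ 𝟘 ∷ 𝟘 ∷ 𝟘 ∷ 𝟘 ∷ 𝟘 ∷ [])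
  ∷ []

h³-rows : Vec (Vec F3 36) 27
h³-rows =
  ( 𝟙 ∷ 𝟘 ∷ 𝟘 ∷ 𝟘 ∷ 𝟙 ∷ 𝟘 ∷ 𝟘 ∷ 𝟘 ∷ 𝟘 ∷ 𝟘 ∷ 𝟘 ∷ 𝟘 ∷ 𝟘 ∷ 𝟘 ∷ 𝟘 ∷ 𝟘 ∷ 𝟘 ∷ 𝟘 ∷ 𝟘 ∷ 𝟘 ∷ 𝟘 ∷ 𝟘 ∷ 𝟘 ∷ 𝟘 ∷ 𝟘 ∷ 𝟘 ∷ 𝟘 ∷ 𝟘 ∷ 𝟘 ∷ 𝟘 ∷ 𝟘 ∷ 𝟘 ∷ 𝟘 ∷ 𝟘 ∷ 𝟘 ∷ 𝟘 ∷ [])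
  ∷ (𝟙 ∷ 𝟙 ∷ 𝟘 ∷ 𝟚 ∷ 𝟘 ∷ 𝟘 ∷ 𝟘 ∷ 𝟘 ∷ 𝟘 ∷ 𝟘 ∷ 𝟘 ∷ 𝟘 ∷ 𝟘 ∷ 𝟘 ∷ 𝟘 ∷ 𝟘 ∷ 𝟘 ∷ 𝟘 ∷ 𝟘 ∷ 𝟘 ∷ 𝟘 ∷ 𝟘 ∷ 𝟘 ∷ 𝟘 ∷ 𝟘 ∷ 𝟘 ∷ 𝟘 ∷ 𝟘 ∷ 𝟘 ∷ 𝟘 ∷ 𝟘 ∷ 𝟘 ∷ 𝟘 ∷ 𝟘 ∷ 𝟘 ∷ 𝟘 ∷ [])
  ∷ (𝟘 ∷ 𝟘 ∷ 𝟘 ∷ 𝟘 ∷ 𝟘 ∷ 𝟘 ∷ 𝟘 ∷ 𝟘 ∷ 𝟘 ∷ 𝟘 ∷ 𝟘 ∷ 𝟘 ∷ 𝟘 ∷ 𝟘 ∷ 𝟘 ∷ 𝟘 ∷ 𝟘 ∷ 𝟘 ∷ 𝟘 ∷ 𝟘 ∷ 𝟘 ∷ 𝟘 ∷ 𝟘 ∷ 𝟘 ∷ 𝟘 ∷ 𝟘 ∷ 𝟘 ∷ 𝟘 ∷ 𝟘 ∷ 𝟘 ∷ 𝟘 ∷ 𝟘 ∷ 𝟘 ∷ 𝟘 ∷ 𝟘 ∷ 𝟘 ∷ [])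
  ∷ (𝟙 ∷ 𝟚 ∷ 𝟘 ∷ 𝟙 ∷ 𝟘 ∷ 𝟘 ∷ 𝟘 ∷ 𝟘 ∷ 𝟘 ∷ 𝟘 ∷ 𝟘 ∷ 𝟘 ∷ 𝟘 ∷ 𝟘 ∷ 𝟘 ∷ 𝟘 ∷ 𝟘 ∷ 𝟘 ∷ 𝟘 ∷ 𝟘 ∷ 𝟘 ∷ 𝟘 ∷ 𝟘 ∷ 𝟘 ∷ 𝟘 ∷ 𝟘 ∷ 𝟘 ∷ 𝟘 ∷ 𝟘 ∷ 𝟘 ∷ 𝟘 ∷ 𝟘 ∷ 𝟘 ∷ 𝟘 ∷ 𝟘 ∷ 𝟘 ∷ [])
  ∷ (𝟚 ∷ 𝟙 ∷ 𝟘 ∷ 𝟙 ∷ 𝟙 ∷ 𝟘 ∷ 𝟘 ∷ 𝟘 ∷ 𝟘 ∷ 𝟘 ∷ 𝟘 ∷ 𝟘 ∷ 𝟘 ∷ 𝟘 ∷ 𝟘 ∷ 𝟘 ∷ 𝟘 ∷ 𝟘 ∷ 𝟘 ∷ 𝟘 ∷ 𝟘 ∷ 𝟘 ∷ 𝟘 ∷ 𝟘 ∷ 𝟘 ∷ 𝟘 ∷ 𝟘 ∷ 𝟘 ∷ 𝟘 ∷ 𝟘 ∷ 𝟘 ∷ 𝟘 ∷ 𝟘 ∷ 𝟘 ∷ 𝟘 ∷ 𝟘 ∷ [])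
  ∷ (𝟘 ∷ 𝟘 ∷ 𝟘 ∷ 𝟘 ∷ 𝟘 ∷ 𝟘 ∷ 𝟘 ∷ 𝟘 ∷ 𝟘 ∷ 𝟘 ∷ 𝟘 ∷ 𝟘 ∷ 𝟘 ∷ 𝟘 ∷ 𝟘 ∷ 𝟘 ∷ 𝟘 ∷ 𝟘 ∷ 𝟘 ∷ 𝟘 ∷ 𝟘 ∷ 𝟘 ∷ 𝟘 ∷ 𝟘 ∷ 𝟘 ∷ 𝟘 ∷ 𝟘 ∷ 𝟘 ∷ 𝟘 ∷ 𝟘 ∷ 𝟘 ∷ 𝟘 ∷ 𝟘 ∷ 𝟘 ∷ 𝟘 ∷ 𝟘 ∷ [])
  ∷ (𝟘 ∷ 𝟘 ∷ 𝟘 ∷ 𝟘 ∷ 𝟘 ∷ 𝟘 ∷ 𝟘 ∷ 𝟘 ∷ 𝟘 ∷ 𝟘 ∷ 𝟘 ∷ 𝟘 ∷ 𝟘 ∷ 𝟘 ∷ 𝟘 ∷ 𝟘 ∷ 𝟘 ∷ 𝟘 ∷ 𝟘 ∷ 𝟘 ∷ 𝟘 ∷ 𝟘 ∷ 𝟘 ∷ 𝟘 ∷ 𝟘 ∷ 𝟘 ∷ 𝟘 ∷ 𝟘 ∷ 𝟘 ∷ 𝟘 ∷ 𝟘 ∷ 𝟘 ∷ 𝟘 ∷ 𝟘 ∷ 𝟘 ∷ 𝟘 ∷ [])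
  ∷ (𝟘 ∷ 𝟘 ∷ 𝟘 ∷ 𝟘 ∷ 𝟘 ∷ 𝟘 ∷ 𝟘 ∷ 𝟘 ∷ 𝟘 ∷ 𝟘 ∷ 𝟘 ∷ 𝟘 ∷ 𝟘 ∷ 𝟘 ∷ 𝟘 ∷ 𝟘 ∷ 𝟘 ∷ 𝟘 ∷ 𝟘 ∷ 𝟘 ∷ 𝟘 ∷ 𝟘 ∷ 𝟘 ∷ 𝟘 ∷ 𝟘 ∷ 𝟘 ∷ 𝟘 ∷ 𝟘 ∷ 𝟘 ∷ 𝟘 ∷ 𝟘 ∷ 𝟘 ∷ 𝟘 ∷ 𝟘 ∷ 𝟘 ∷ 𝟘 ∷ [])
  ∷ (𝟘 ∷ 𝟘 ∷ 𝟘 ∷ 𝟘 ∷ 𝟘 ∷ 𝟘 ∷ 𝟘 ∷ 𝟘 ∷ 𝟘 ∷ 𝟘 ∷ 𝟘 ∷ 𝟘 ∷ 𝟘 ∷ 𝟘 ∷ 𝟘 ∷ 𝟘 ∷ 𝟘 ∷ 𝟘 ∷ 𝟘 ∷ 𝟘 ∷ 𝟘 ∷ 𝟘 ∷ 𝟘 ∷ 𝟘 ∷ 𝟘 ∷ 𝟘 ∷ 𝟘 ∷ 𝟘 ∷ 𝟘 ∷ 𝟘 ∷ 𝟘 ∷ 𝟘 ∷ 𝟘 ∷ 𝟘 ∷ 𝟘 ∷ 𝟘 ∷ [])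
  ∷ (𝟘 ∷ 𝟚 ∷ 𝟘 ∷ 𝟚 ∷ 𝟚 ∷ 𝟘 ∷ 𝟘 ∷ 𝟘 ∷ 𝟘 ∷ 𝟚 ∷ 𝟘 ∷ 𝟘 ∷ 𝟘 ∷ 𝟘 ∷ 𝟘 ∷ 𝟘 ∷ 𝟘 ∷ 𝟘 ∷ 𝟘 ∷ 𝟘 ∷ 𝟘 ∷ 𝟘 ∷ 𝟘 ∷ 𝟘 ∷ 𝟘 ∷ 𝟘 ∷ 𝟘 ∷ 𝟘 ∷ 𝟘 ∷ 𝟘 ∷ 𝟘 ∷ 𝟘 ∷ 𝟘 ∷ 𝟘 ∷ 𝟘 ∷ 𝟘 ∷ [])
  ∷ (𝟘 ∷ 𝟘 ∷ 𝟘 ∷ 𝟘 ∷ 𝟘 ∷ 𝟘 ∷ 𝟘 ∷ 𝟘 ∷ 𝟘 ∷ 𝟘 ∷ 𝟘 ∷ 𝟘 ∷ 𝟘 ∷ 𝟘 ∷ 𝟘 ∷ 𝟘 ∷ 𝟘 ∷ 𝟘 ∷ 𝟘 ∷ 𝟘 ∷ 𝟘 ∷ 𝟘 ∷ 𝟘 ∷ 𝟘 ∷ 𝟘 ∷ 𝟘 ∷ 𝟘 ∷ 𝟘 ∷ 𝟘 ∷ 𝟘 ∷ 𝟘 ∷ 𝟘 ∷ 𝟘 ∷ 𝟘 ∷ 𝟘 ∷ 𝟘 ∷ [])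
  ∷ (𝟘 ∷ 𝟘 ∷ 𝟘 ∷ 𝟘 ∷ 𝟘 ∷ 𝟘 ∷ 𝟘 ∷ 𝟘 ∷ 𝟘 ∷ 𝟘 ∷ 𝟘 ∷ 𝟘 ∷ 𝟘 ∷ 𝟘 ∷ 𝟘 ∷ 𝟘 ∷ 𝟘 ∷ 𝟘 ∷ 𝟘 ∷ 𝟘 ∷ 𝟘 ∷ 𝟘 ∷ 𝟘 ∷ 𝟘 ∷ 𝟘 ∷ 𝟘 ∷ 𝟘 ∷ 𝟘 ∷ 𝟘 ∷ 𝟘 ∷ 𝟘 ∷ 𝟘 ∷ 𝟘 ∷ 𝟘 ∷ 𝟘 ∷ 𝟘 ∷ [])
  ∷ (𝟘 ∷ 𝟘 ∷ 𝟘 ∷ 𝟘 ∷ 𝟘 ∷ 𝟘 ∷ 𝟘 ∷ 𝟘 ∷ 𝟘 ∷ 𝟘 ∷ 𝟘 ∷ 𝟘 ∷ 𝟘 ∷ 𝟘 ∷ 𝟘 ∷ 𝟘 ∷ 𝟘 ∷ 𝟘 ∷ 𝟘 ∷ 𝟘 ∷ 𝟘 ∷ 𝟘 ∷ 𝟘 ∷ 𝟘 ∷ 𝟘 ∷ 𝟘 ∷ 𝟘 ∷ 𝟘 ∷ 𝟘 ∷ 𝟘 ∷ 𝟘 ∷ 𝟘 ∷ 𝟘 ∷ 𝟘 ∷ 𝟘 ∷ 𝟘 ∷ [])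
  ∷ (𝟘 ∷ 𝟘 ∷ 𝟘 ∷ 𝟘 ∷ 𝟘 ∷ 𝟘 ∷ 𝟘 ∷ 𝟘 ∷ 𝟘 ∷ 𝟘 ∷ 𝟘 ∷ 𝟘 ∷ 𝟘 ∷ 𝟘 ∷ 𝟘 ∷ 𝟘 ∷ 𝟘 ∷ 𝟘 ∷ 𝟘 ∷ 𝟘 ∷ 𝟘 ∷ 𝟘 ∷ 𝟘 ∷ 𝟘 ∷ 𝟘 ∷ 𝟘 ∷ 𝟘 ∷ 𝟘 ∷ 𝟘 ∷ 𝟘 ∷ 𝟘 ∷ 𝟘 ∷ 𝟘 ∷ 𝟘 ∷ 𝟘 ∷ 𝟘 ∷ [])
  ∷ (𝟘 ∷ 𝟘 ∷ 𝟘 ∷ 𝟘 ∷ 𝟘 ∷ 𝟘 ∷ 𝟘 ∷ 𝟘 ∷ 𝟘 ∷ 𝟘 ∷ 𝟘 ∷ 𝟘 ∷ 𝟘 ∷ 𝟘 ∷ 𝟘 ∷ 𝟘 ∷ 𝟘 ∷ 𝟘 ∷ 𝟘 ∷ 𝟘 ∷ 𝟘 ∷ 𝟘 ∷ 𝟘 ∷ 𝟘 ∷ 𝟘 ∷ 𝟘 ∷ 𝟘 ∷ 𝟘 ∷ 𝟘 ∷ 𝟘 ∷ 𝟘 ∷ 𝟘 ∷ 𝟘 ∷ 𝟘 ∷ 𝟘 ∷ 𝟘 ∷ [])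
  ∷ (𝟘 ∷ 𝟘 ∷ 𝟘 ∷ 𝟘 ∷ 𝟘 ∷ 𝟘 ∷ 𝟘 ∷ 𝟘 ∷ 𝟘 ∷ 𝟘 ∷ 𝟘 ∷ 𝟘 ∷ 𝟘 ∷ 𝟘 ∷ 𝟘 ∷ 𝟘 ∷ 𝟘 ∷ 𝟘 ∷ 𝟘 ∷ 𝟘 ∷ 𝟘 ∷ 𝟘 ∷ 𝟘 ∷ 𝟘 ∷ 𝟘 ∷ 𝟘 ∷ 𝟘 ∷ 𝟘 ∷ 𝟘 ∷ 𝟘 ∷ 𝟘 ∷ 𝟘 ∷ 𝟘 ∷ 𝟘 ∷ 𝟘 ∷ 𝟘 ∷ [])
  ∷ (𝟘 ∷ 𝟘 ∷ 𝟘 ∷ 𝟘 ∷ 𝟘 ∷ 𝟘 ∷ 𝟘 ∷ 𝟘 ∷ 𝟘 ∷ 𝟘 ∷ 𝟘 ∷ 𝟘 ∷ 𝟘 ∷ 𝟘 ∷ 𝟘 ∷ 𝟘 ∷ 𝟘 ∷ 𝟘 ∷ 𝟘 ∷ 𝟘 ∷ 𝟘 ∷ 𝟘 ∷ 𝟘 ∷ 𝟘 ∷ 𝟘 ∷ 𝟘 ∷ 𝟘 ∷ 𝟘 ∷ 𝟘 ∷ 𝟘 ∷ 𝟘 ∷ 𝟘 ∷ 𝟘 ∷ 𝟘 ∷ 𝟘 ∷ 𝟘 ∷ [])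
  ∷ (𝟘 ∷ 𝟘 ∷ 𝟘 ∷ 𝟘 ∷ 𝟘 ∷ 𝟘 ∷ 𝟘 ∷ 𝟘 ∷ 𝟘 ∷ 𝟘 ∷ 𝟘 ∷ 𝟘 ∷ 𝟘 ∷ 𝟘 ∷ 𝟘 ∷ 𝟘 ∷ 𝟘 ∷ 𝟘 ∷ 𝟘 ∷ 𝟘 ∷ 𝟘 ∷ 𝟘 ∷ 𝟘 ∷ 𝟘 ∷ 𝟘 ∷ 𝟘 ∷ 𝟘 ∷ 𝟘 ∷ 𝟘 ∷ 𝟘 ∷ 𝟘 ∷ 𝟘 ∷ 𝟘 ∷ 𝟘 ∷ 𝟘 ∷ 𝟘 ∷ [])
  ∷ (𝟘 ∷ 𝟘 ∷ 𝟘 ∷ 𝟘 ∷ 𝟘 ∷ 𝟘 ∷ 𝟘 ∷ 𝟘 ∷ 𝟘 ∷ 𝟘 ∷ 𝟘 ∷ 𝟘 ∷ 𝟘 ∷ 𝟘 ∷ 𝟘 ∷ 𝟘 ∷ 𝟘 ∷ 𝟘 ∷ 𝟙 ∷ 𝟘 ∷ 𝟘 ∷ 𝟘 ∷ 𝟙 ∷ 𝟘 ∷ 𝟘 ∷ 𝟘 ∷ 𝟘 ∷ 𝟘 ∷ 𝟘 ∷ 𝟘 ∷ 𝟘 ∷ 𝟘 ∷ 𝟘 ∷ 𝟘 ∷ 𝟘 ∷ 𝟘 ∷ [])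
  ∷ (𝟘 ∷ 𝟘 ∷ 𝟘 ∷ 𝟘 ∷ 𝟘 ∷ 𝟘 ∷ 𝟘 ∷ 𝟘 ∷ 𝟘 ∷ 𝟘 ∷ 𝟘 ∷ 𝟘 ∷ 𝟘 ∷ 𝟘 ∷ 𝟘 ∷ 𝟘 ∷ 𝟘 ∷ 𝟘 ∷ 𝟙 ∷ 𝟙 ∷ 𝟘 ∷ 𝟚 ∷ 𝟘 ∷ 𝟘 ∷ 𝟘 ∷ 𝟘 ∷ 𝟘 ∷ 𝟘 ∷ 𝟘 ∷ 𝟘 ∷ 𝟘 ∷ 𝟘 ∷ 𝟘 ∷ 𝟘 ∷ 𝟘 ∷ 𝟘 ∷ [])
  ∷ (𝟘 ∷ 𝟘 ∷ 𝟘 ∷ 𝟘 ∷ 𝟘 ∷ 𝟘 ∷ 𝟘 ∷ 𝟘 ∷ 𝟘 ∷ 𝟘 ∷ 𝟘 ∷ 𝟘 ∷ 𝟘 ∷ 𝟘 ∷ 𝟘 ∷ 𝟘 ∷ 𝟘 ∷ 𝟘 ∷ 𝟘 ∷ 𝟘 ∷ 𝟘 ∷ 𝟘 ∷ 𝟘 ∷ 𝟘 ∷ 𝟘 ∷ 𝟘 ∷ 𝟘 ∷ 𝟘 ∷ 𝟘 ∷ 𝟘 ∷ 𝟘 ∷ 𝟘 ∷ 𝟘 ∷ 𝟘 ∷ 𝟘 ∷ 𝟘 ∷ [])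
  ∷ (𝟘 ∷ 𝟘 ∷ 𝟘 ∷ 𝟘 ∷ 𝟘 ∷ 𝟘 ∷ 𝟘 ∷ 𝟘 ∷ 𝟘 ∷ 𝟘 ∷ 𝟘 ∷ 𝟘 ∷ 𝟘 ∷ 𝟘 ∷ 𝟘 ∷ 𝟘 ∷ 𝟘 ∷ 𝟘 ∷ 𝟙 ∷ 𝟚 ∷ 𝟘 ∷ 𝟙 ∷ 𝟘 ∷ 𝟘 ∷ 𝟘 ∷ 𝟘 ∷ 𝟘 ∷ 𝟘 ∷ 𝟘 ∷ 𝟘 ∷ 𝟘 ∷ 𝟘 ∷ 𝟘 ∷ 𝟘 ∷ 𝟘 ∷ 𝟘 ∷ [])
  ∷ (𝟘 ∷ 𝟘 ∷ 𝟘 ∷ 𝟘 ∷ 𝟘 ∷ 𝟘 ∷ 𝟘 ∷ 𝟘 ∷ 𝟘 ∷ 𝟘 ∷ 𝟘 ∷ 𝟘 ∷ 𝟘 ∷ 𝟘 ∷ 𝟘 ∷ 𝟘 ∷ 𝟘 ∷ 𝟘 ∷ 𝟚 ∷ 𝟙 ∷ 𝟘 ∷ 𝟙 ∷ 𝟙 ∷ 𝟘 ∷ 𝟘 ∷ 𝟘 ∷ 𝟘 ∷ 𝟘 ∷ 𝟘 ∷ 𝟘 ∷ 𝟘 ∷ 𝟘 ∷ 𝟘 ∷ 𝟘 ∷ 𝟘 ∷ 𝟘 ∷ [])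
  ∷ (𝟘 ∷ 𝟘 ∷ 𝟘 ∷ 𝟘 ∷ 𝟘 ∷ 𝟘 ∷ 𝟘 ∷ 𝟘 ∷ 𝟘 ∷ 𝟘 ∷ 𝟘 ∷ 𝟘 ∷ 𝟘 ∷ 𝟘 ∷ 𝟘 ∷ 𝟘 ∷ 𝟘 ∷ 𝟘 ∷ 𝟘 ∷ 𝟘 ∷ 𝟘 ∷ 𝟘 ∷ 𝟘 ∷ 𝟘 ∷ 𝟘 ∷ 𝟘 ∷ 𝟘 ∷ 𝟘 ∷ 𝟘 ∷ 𝟘 ∷ 𝟘 ∷ 𝟘 ∷ 𝟘 ∷ 𝟘 ∷ 𝟘 ∷ 𝟘 ∷ [])
  ∷ (𝟘 ∷ 𝟘 ∷ 𝟘 ∷ 𝟘 ∷ 𝟘 ∷ 𝟘 ∷ 𝟘 ∷ 𝟘 ∷ 𝟘 ∷ 𝟘 ∷ 𝟘 ∷ 𝟘 ∷ 𝟘 ∷ 𝟘 ∷ 𝟘 ∷ 𝟘 ∷ 𝟘 ∷ 𝟘 ∷ 𝟘 ∷ 𝟘 ∷ 𝟘 ∷ 𝟘 ∷ 𝟘 ∷ 𝟘 ∷ 𝟘 ∷ 𝟘 ∷ 𝟘 ∷ 𝟘 ∷ 𝟘 ∷ 𝟘 ∷ 𝟘 ∷ 𝟘 ∷ 𝟘 ∷ 𝟘 ∷ 𝟘 ∷ 𝟘 ∷ [])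
  ∷ (𝟘 ∷ 𝟘 ∷ 𝟘 ∷ 𝟘 ∷ 𝟘 ∷ 𝟘 ∷ 𝟘 ∷ 𝟘 ∷ 𝟘 ∷ 𝟘 ∷ 𝟘 ∷ 𝟘 ∷ 𝟘 ∷ 𝟘 ∷ 𝟘 ∷ 𝟘 ∷ 𝟘 ∷ 𝟘 ∷ 𝟘 ∷ 𝟘 ∷ 𝟘 ∷ 𝟘 ∷ 𝟘 ∷ 𝟘 ∷ 𝟘 ∷ 𝟘 ∷ 𝟘 ∷ 𝟘 ∷ 𝟘 ∷ 𝟘 ∷ 𝟘 ∷ 𝟘 ∷ 𝟘 ∷ 𝟘 ∷ 𝟘 ∷ 𝟘 ∷ [])
  ∷ (𝟘 ∷ 𝟘 ∷ 𝟘 ∷ 𝟘 ∷ 𝟘 ∷ 𝟘 ∷ 𝟘 ∷ 𝟘 ∷ 𝟘 ∷ 𝟘 ∷ 𝟘 ∷ 𝟘 ∷ 𝟘 ∷ 𝟘 ∷ 𝟘 ∷ 𝟘 ∷ 𝟘 ∷ 𝟘 ∷ 𝟘 ∷ 𝟘 ∷ 𝟘 ∷ 𝟘 ∷ 𝟘 ∷ 𝟘 ∷ 𝟘 ∷ 𝟘 ∷ 𝟘 ∷ 𝟘 ∷ 𝟘 ∷ 𝟘 ∷ 𝟘 ∷ 𝟘 ∷ 𝟘 ∷ 𝟘 ∷ 𝟘 ∷ 𝟘 ∷ [])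
  ∷ []

coordinates : M3 → Vec F3 13
coordinates = applyMatrix 3 coordinate-rows

h² : M3 → M2
h² w = unflat 2 (applyMatrix 3 h²-rows w)

h³ : M4 → M3
h³ w = unflat 3 (applyMatrix 4 h³-rows w)

splitting : M3 → M3
splitting w = (lincomb (coordinates w) basis +M3 d1 (h² w)) +M3 h³ (d2 w)

h³-zero : h³ 0M4 ≡ 0M3
h³-zero = refl

coordinates-additive : Additive _+M3_ _+V_ coordinates
coordinates-additive = applyMatrix-additive 3 coordinate-rows

h²-additive : Additive _+M3_ _+M2_ h²
h²-additive = additive-∘ _+M3_ _+V_ _+M2_ {unflat 2} {applyMatrix 3 h²-rows}
  (unflat-additive 2) (applyMatrix-additive 3 h²-rows)

h³-additive : Additive _+M4_ _+M3_ h³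
h³-additive = additive-∘ _+M4_ _+V_ _+M3_ {unflat 3} {applyMatrix 4 h³-rows}
  (unflat-additive 3) (applyMatrix-additive 4 h³-rows)

splitting-additive : Additive _+M3_ _+M3_ splitting
splitting-additive =
  additive-+ _+M3_ _+M3_ +M3.interchange {λ w → lincomb (coordinates w) basis +M3 d1 (h² w)} {λ w → h³ (d2 w)}
    (additive-+ _+M3_ _+M3_ +M3.interchange {λ w → lincomb (coordinates w) basis} {λ w → d1 (h² w)}
      (additive-∘ _+M3_ _+V_ _+M3_ {λ c → lincomb c basis} {coordinates}
        (lincomb-additive basis) coordinates-additive)
      (additive-∘ _+M3_ _+M2_ _+M3_ {d1} {h²} d1-additive h²-additive))
    (additive-∘ _+M3_ _+M4_ _+M3_ {h³} {d2} h³-additive d2-additive)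

-- The finite checks are decided rather than proved by refl: a conversion check between two
-- elements of M built by tabulate would compare them symbolically, under the binders.
splitting-identity : ∀ w → w ≡ splitting w
splitting-identity = additive-uniqueⁿ _+M3_ 3 (λ w → w) splitting (λ _ _ → refl)
  (additive-change-domain _+M3_ _+M3_ (zipWithⁿ _+M_ 3) (λ _ _ → refl) {splitting} splitting-additive)
  (from-yes (≟ⁿ 3 (unflat 3 (replicate _ 𝟘)) (splitting (unflat 3 (replicate _ 𝟘)))))
  (from-yes (all? λ k → ≟ⁿ 3 (unflat 3 (unit k)) (splitting (unflat 3 (unit k)))))

coordinates-basis : ∀ c → coordinates (lincomb c basis) ≡ c
coordinates-basis = additive-unique _+V_ (λ c → coordinates (lincomb c basis)) (λ c → c)
  (additive-∘ _+V_ _+M3_ _+V_ {coordinates} {λ c → lincomb c basis}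
    coordinates-additive (lincomb-additive basis))
  (λ _ _ → refl) refl
  (from-yes (all? λ k → Vec.≡-dec _≟₃_ (coordinates (lincomb (unit k) basis)) (unit k)))

coordinates-d1 : ∀ ab → coordinates (d1 ab) ≡ replicate 13 𝟘
coordinates-d1 = additive-uniqueⁿ _+V_ 2 (λ ab → coordinates (d1 ab)) (λ _ → replicate 13 𝟘)
  (additive-change-domain _+M2_ _+V_ (zipWithⁿ _+M_ 2) (λ _ _ → refl) {λ ab → coordinates (d1 ab)}
    (additive-∘ _+M2_ _+M3_ _+V_ {coordinates} {d1} coordinates-additive d1-additive))
  (λ _ _ → sym (+V-identityˡ (replicate 13 𝟘))) refl
  (from-yes (all? λ k → Vec.≡-dec _≟₃_ (coordinates (d1 (unflat 2 (unit k)))) (replicate 13 𝟘)))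

basis-decompositions : (i : Fin 13) → d2 (lookup basis i) ≡ 0M4
basis-decompositions = from-yes (all? λ i → ≟ⁿ 4 (d2 (lookup basis i)) 0M4)

proposition7p6 : ((i : Fin 13) → d2 (lookup basis i) ≡ 0M4)
    × ((c : Vec F3 13) → ∃ (λ (ab : M2) → d1 ab ≡ lincomb c basis) → c ≡ replicate 13 𝟘)
    × ((w : M3) → d2 w ≡ 0M4 → ∃ (λ (c : Vec F3 13) → ∃ (λ (ab : M2) → w ≡ lincomb c basis +M3 d1 ab)))
proposition7p6 = basis-decompositions , independent , spanning
  where
  independent : (c : Vec F3 13) → ∃ (λ (ab : M2) → d1 ab ≡ lincomb c basis) → c ≡ replicate 13 𝟘
  independent c (ab , d1ab≡) = begin
    c                               ≡⟨ coordinates-basis c ⟨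
    coordinates (lincomb c basis)   ≡⟨ cong coordinates d1ab≡ ⟨
    coordinates (d1 ab)             ≡⟨ coordinates-d1 ab ⟩
    replicate 13 𝟘                  ∎

  spanning : (w : M3) → d2 w ≡ 0M4 → ∃ (λ (c : Vec F3 13) → ∃ (λ (ab : M2) → w ≡ lincomb c basis +M3 d1 ab))
  spanning w d2w≡0 = coordinates w , h² w , (begin
    w                        ≡⟨ splitting-identity w ⟩
    decomposition +M3 h³ (d2 w)    ≡⟨ cong (λ v → decomposition +M3 h³ v) d2w≡0 ⟩
    decomposition +M3 h³ 0M4       ≡⟨ cong (decomposition +M3_) h³-zero ⟩
    decomposition +M3 0M3          ≡⟨ +M3-identityʳ decomposition ⟩
    decomposition                  ∎)
    where
    decomposition : M3
    decomposition = lincomb (coordinates w) basis +M3 d1 (h² w)
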